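{- Let $\mathcal{C}$ be a category in which the two maps $[\mathrm{id},\kappa_2],[[\kappa_2,\kappa_1],\kappa_2]\colon(X+X)+X\rightrightarrows X+X$ are jointly monic. The resulting partially defined operation $\boxplus$ on predicates: (i) is commutative: if $p\perp q$ then $q\perp p$ and $p\boxplus q=q\boxplus p$; (ii) has $0=\kappa_2$ as neutral element: $0\perp p$ and $0\boxplus p=p$; (iii) is associative if the square (E) is a pullback: if $p\perp q$ and $p\boxplus q\perp r$, then $q\perp r$ and $p\perp q\boxplus r$, and $(p\boxplus q)\boxplus r=p\boxplus(q\boxplus r)$; (iv) satisfies $p\boxplus p^\perp=1$; (v) if the square (K) is a pullback, then $p^\perp$ is the sole predicate $q$ with $p\boxplus q=1$; (vi) if the square (K+) is a pullback, then $1\perp p$ implies $p=0$.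
   Context: A predicate on $X$ is a map $p\colon X\to X+X$ with $\nabla\circ p=\mathrm{id}$, $\nabla=[\mathrm{id},\mathrm{id}]$; truth $1=\kappa_1$, falsity $0=\kappa_2$, orthocomplement $p^\perp=[\kappa_2,\kappa_1]\circ p$. Predicates $p,q$ are orthogonal, $p\perp q$, if there is a (necessarily unique) bound $b\colon X\to(X+X)+X$ with $[\mathrm{id},\kappa_2]\circ b=p$ and $[[\kappa_2,\kappa_1],\kappa_2]\circ b=q$; then $p\boxplus q=(\nabla+\mathrm{id})\circ b$. Square (E): $\mathrm{id}+g\colon A+X\to A+Y$ and $\mathrm{id}+g\colon B+X\to B+Y$ with verticals $f+\mathrm{id}$. Square (K): $f\colon X\to Y$ on top, $f+\mathrm{id}\colon X+A\to Y+A$ on the bottom, verticals $\kappa_1$. Square (K+): $f\colon X\to Y$ on top, $f+g\colon X+A\to Y+B$ on the bottom, verticals $\kappa_1$. Here $\boxplus$ denotes the partial sum operation. -}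

module Defs where

open import Level using (Level; _⊔_) renaming (suc to lsuc)
open import Data.Product using (Σ; _×_; _,_; proj₁; proj₂)
open import Relation.Binary.PropositionalEquality
  using (_≡_; refl; sym; trans; cong; cong₂; module ≡-Reasoning)

-- A category (hom-sets with propositional equality) with chosen binary coproducts.
record CoprodCategory (o ℓ : Level) : Set (lsuc (o ⊔ ℓ)) where
  infixr 9 _∘_
  infixr 6 _+_
  field
    Obj : Set o
    Hom : Obj → Obj → Set ℓ
    id  : ∀ {A} → Hom A A
    _∘_ : ∀ {A B C} → Hom B C → Hom A B → Hom A C
    assoc : ∀ {A B C D} {f : Hom A B} {g : Hom B C} {h : Hom C D} →
            (h ∘ g) ∘ f ≡ h ∘ (g ∘ f)
    identityˡ : ∀ {A B} {f : Hom A B} → id ∘ f ≡ f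
    identityʳ : ∀ {A B} {f : Hom A B} → f ∘ id ≡ f
    _+_ : Obj → Obj → Obj
    κ₁ : ∀ {A B} → Hom A (A + B)
    κ₂ : ∀ {A B} → Hom B (A + B)
    [_,_] : ∀ {A B C} → Hom A C → Hom B C → Hom (A + B) C
    inject₁ : ∀ {A B C} {f : Hom A C} {g : Hom B C} → [ f , g ] ∘ κ₁ ≡ f
    inject₂ : ∀ {A B C} {f : Hom A C} {g : Hom B C} → [ f , g ] ∘ κ₂ ≡ g
    unique : ∀ {A B C} {f : Hom A C} {g : Hom B C} {h : Hom (A + B) C} →
             h ∘ κ₁ ≡ f → h ∘ κ₂ ≡ g → h ≡ [ f , g ]

  infixr 7 _+₁_
  _+₁_ : ∀ {A B C D} → Hom A B → Hom C D → Hom (A + C) (B + D)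
  f +₁ g = [ κ₁ ∘ f , κ₂ ∘ g ]

  ∇ : ∀ {A} → Hom (A + A) A
  ∇ = [ id , id ]

module Predicates {o ℓ : Level} (𝒞 : CoprodCategory o ℓ) where
  open CoprodCategory 𝒞
  open ≡-Reasoning

  -- pullback squares:   P --p₁--> A
  --                     |p₂       |f
  --                     B --g---> C
  IsPullback : ∀ {P A B C} → Hom P A → Hom P B → Hom A C → Hom B C → Set (o ⊔ ℓ)
  IsPullback {P} {A} {B} p₁ p₂ f g =
    (f ∘ p₁ ≡ g ∘ p₂) ×
    (∀ {Z} (a : Hom Z A) (b : Hom Z B) → f ∘ a ≡ g ∘ b →
       Σ (Hom Z P) λ u → ((p₁ ∘ u ≡ a) × (p₂ ∘ u ≡ b)) ×
         (∀ (v : Hom Z P) → p₁ ∘ v ≡ a → p₂ ∘ v ≡ b → v ≡ u))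

  δ₁ : ∀ {X} → Hom ((X + X) + X) (X + X)
  δ₁ = [ id , κ₂ ]

  δ₂ : ∀ {X} → Hom ((X + X) + X) (X + X)
  δ₂ = [ [ κ₂ , κ₁ ] , κ₂ ]

  JointlyMonic : Set (o ⊔ ℓ)
  JointlyMonic = ∀ {X Z} (h k : Hom Z ((X + X) + X)) →
    δ₁ ∘ h ≡ δ₁ ∘ k → δ₂ ∘ h ≡ δ₂ ∘ k → h ≡ k

  SquareE : Set (o ⊔ ℓ)
  SquareE = ∀ {A B X Y} (f : Hom A B) (g : Hom X Y) →
    IsPullback (id +₁ g) (f +₁ id) (f +₁ id) (id +₁ g)

  SquareK : Set (o ⊔ ℓ)
  SquareK = ∀ {X Y A} (f : Hom X Y) →
    IsPullback f κ₁ κ₁ (f +₁ id {A})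

  SquareK+ : Set (o ⊔ ℓ)
  SquareK+ = ∀ {X Y A B} (f : Hom X Y) (g : Hom A B) →
    IsPullback f κ₁ κ₁ (f +₁ g)

  record Pred (X : Obj) : Set ℓ where
    constructor pred
    field
      pr   : Hom X (X + X)
      pr-∇ : ∇ ∘ pr ≡ id
  open Pred public

  𝟏 : ∀ {X} → Pred X
  𝟏 = pred κ₁ inject₁

  𝟎 : ∀ {X} → Pred X
  𝟎 = pred κ₂ inject₂

  ∇-swap : ∀ {X} → ∇ {X} ∘ [ κ₂ , κ₁ ] ≡ ∇
  ∇-swap = unique (trans assoc (trans (cong (∇ ∘_) inject₁) inject₂))
                  (trans assoc (trans (cong (∇ ∘_) inject₂) inject₁))

  _⊥ : ∀ {X} → Pred X → Pred X
  (p ⊥) = pred ([ κ₂ , κ₁ ] ∘ pr p)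
               (trans (sym assoc) (trans (cong (_∘ pr p) ∇-swap) (pr-∇ p)))

  Bound : ∀ {X} → Pred X → Pred X → Hom X ((X + X) + X) → Set ℓ
  Bound p q b = (δ₁ ∘ b ≡ pr p) × (δ₂ ∘ b ≡ pr q)

  _⊥⊥_ : ∀ {X} → Pred X → Pred X → Set ℓ
  _⊥⊥_ {X} p q = Σ (Hom X ((X + X) + X)) λ b → Bound p q b

  ∇∇ : ∀ {X} → ∇ {X} ∘ (∇ +₁ id) ≡ ∇ ∘ δ₁
  ∇∇ = trans (unique e1 e2) (sym (unique f1 f2))
    where
    e1 = begin
      (∇ ∘ (∇ +₁ id)) ∘ κ₁ ≡⟨ assoc ⟩
      ∇ ∘ ((∇ +₁ id) ∘ κ₁) ≡⟨ cong (∇ ∘_) inject₁ ⟩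
      ∇ ∘ (κ₁ ∘ ∇)        ≡⟨ sym assoc ⟩
      (∇ ∘ κ₁) ∘ ∇        ≡⟨ cong (_∘ ∇) inject₁ ⟩
      id ∘ ∇              ≡⟨ identityˡ ⟩
      ∇ ∎
    e2 = begin
      (∇ ∘ (∇ +₁ id)) ∘ κ₂ ≡⟨ assoc ⟩
      ∇ ∘ ((∇ +₁ id) ∘ κ₂) ≡⟨ cong (∇ ∘_) inject₂ ⟩
      ∇ ∘ (κ₂ ∘ id)        ≡⟨ cong (∇ ∘_) identityʳ ⟩
      ∇ ∘ κ₂               ≡⟨ inject₂ ⟩
      id ∎
    f1 = trans assoc (trans (cong (∇ ∘_) inject₁) identityʳ)
    f2 = trans assoc (trans (cong (∇ ∘_) inject₂) inject₂)

  ⊞ : ∀ {X} (p q : Pred X) → p ⊥⊥ q → Pred X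
  syntax ⊞ p q o = p ⊞[ o ] q
  ⊞ p q (b , e₁ , e₂) = pred ((∇ +₁ id) ∘ b) (begin
      ∇ ∘ ((∇ +₁ id) ∘ b) ≡⟨ sym assoc ⟩
      (∇ ∘ (∇ +₁ id)) ∘ b ≡⟨ cong (_∘ b) ∇∇ ⟩
      (∇ ∘ δ₁) ∘ b        ≡⟨ assoc ⟩
      ∇ ∘ (δ₁ ∘ b)        ≡⟨ cong (∇ ∘_) e₁ ⟩
      ∇ ∘ pr p            ≡⟨ pr-∇ p ⟩
      id ∎)

module Submission where

-- Almost every step of the proof is an equation between "structural" maps,
-- i.e. maps between iterated coproducts X + X, (X + X) + X, ... built from
-- injections, copairings and codiagonals.  Such a map only moves summands
-- around: it is induced by a function between the finite sets of summands
-- ("leaves").  We make this precise once (module Reindexing): every function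
-- m between leaf sets induces a map  reindex m, reindexing respects
-- composition, and two induced maps agree as soon as the leaf functions agree
-- on each of the finitely many leaves, which Agda checks by computation.

open import Defs
open import Data.Product using (Σ; _×_; _,_; proj₁; proj₂)
open import Relation.Binary.PropositionalEquality
  using (_≡_; refl; sym; trans; cong; cong₂; module ≡-Reasoning)

module CoproductCalculus {o ℓ} (𝒞 : CoprodCategory o ℓ) where
  open CoprodCategory 𝒞

  ∘-[] : ∀ {A B C D} {h : Hom C D} {f : Hom A C} {g : Hom B C} →
         h ∘ [ f , g ] ≡ [ h ∘ f , h ∘ g ]
  ∘-[] = unique (trans assoc (cong (_ ∘_) inject₁)) (trans assoc (cong (_ ∘_) inject₂))

  [κ₁,κ₂]≡id : ∀ {A B} → [ κ₁ {A} {B} , κ₂ ] ≡ id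
  [κ₁,κ₂]≡id = sym (unique identityˡ identityˡ)

  precompose : ∀ {A B C D} {M : Hom B C} {N : Hom A B} {K : Hom A C} {b : Hom D A} →
               M ∘ N ≡ K → M ∘ (N ∘ b) ≡ K ∘ b
  precompose e = trans (sym assoc) (cong (_∘ _) e)

  solve-by-retraction : ∀ {A B C} {R : Hom B A} {S : Hom A B} {b : Hom C A} {v : Hom C B} →
                        R ∘ S ≡ id → S ∘ b ≡ v → b ≡ R ∘ v
  solve-by-retraction retraction e =
    sym (trans (cong (_ ∘_) (sym e)) (trans (precompose retraction) identityˡ))

  transfer : ∀ {A B B′ C D} {M : Hom B C} {N : Hom A B} {M′ : Hom B′ C} {N′ : Hom A B′}
               {u : Hom D A} {v : Hom D B′} →
             M ∘ N ≡ M′ ∘ N′ → N′ ∘ u ≡ v → M ∘ (N ∘ u) ≡ M′ ∘ v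
  transfer e e′ = trans (precompose e) (trans assoc (cong (_ ∘_) e′))

-- Shapes of iterated binary coproducts of a single object, and their leaves.
data Shape : Set where
  ●   : Shape
  _⊕_ : Shape → Shape → Shape

infixr 6 _⊕_

data Leaf : Shape → Set where
  here  : Leaf ●
  left  : ∀ {s t} → Leaf s → Leaf (s ⊕ t)
  right : ∀ {s t} → Leaf t → Leaf (s ⊕ t)

idᴸ : ∀ {s} → Leaf s → Leaf s
idᴸ i = i

[_,_]ᴸ : ∀ {s t u} → (Leaf s → Leaf u) → (Leaf t → Leaf u) → Leaf (s ⊕ t) → Leaf u
[ m , n ]ᴸ (left i)  = m i
[ m , n ]ᴸ (right i) = n i

∇ᴸ : ∀ {s} → Leaf (s ⊕ s) → Leaf s
∇ᴸ = [ idᴸ , idᴸ ]ᴸ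

_+ᴸ_ : ∀ {s s′ t t′} → (Leaf s → Leaf s′) → (Leaf t → Leaf t′) → Leaf (s ⊕ t) → Leaf (s′ ⊕ t′)
m +ᴸ n = [ (λ i → left (m i)) , (λ i → right (n i)) ]ᴸ

-- A property holding at every leaf, as a finite product (checked leaf by leaf).
Every : ∀ {s} → (Leaf s → Set) → Set
Every {●}     P = P here
Every {s ⊕ t} P = Every (λ i → P (left i)) × Every (λ i → P (right i))

module Reindexing {o ℓ} (𝒞 : CoprodCategory o ℓ) (X : CoprodCategory.Obj 𝒞) where
  open CoprodCategory 𝒞
  open CoproductCalculus 𝒞
  open ≡-Reasoning

  ⟦_⟧ : Shape → Obj
  ⟦ ● ⟧     = X
  ⟦ s ⊕ t ⟧ = ⟦ s ⟧ + ⟦ t ⟧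

  inj : ∀ {s} → Leaf s → Hom X ⟦ s ⟧
  inj here      = id
  inj (left i)  = κ₁ ∘ inj i
  inj (right i) = κ₂ ∘ inj i

  reindex : ∀ {s t} → (Leaf s → Leaf t) → Hom ⟦ s ⟧ ⟦ t ⟧
  reindex {●}     m = inj (m here)
  reindex {s ⊕ t} m = [ reindex (λ i → m (left i)) , reindex (λ i → m (right i)) ]

  reindex-inj : ∀ {s t} (m : Leaf s → Leaf t) (i : Leaf s) → reindex m ∘ inj i ≡ inj (m i)
  reindex-inj m here      = identityʳ
  reindex-inj m (left i)  = trans (precompose inject₁) (reindex-inj (λ j → m (left j)) i)
  reindex-inj m (right i) = trans (precompose inject₂) (reindex-inj (λ j → m (right j)) i)

  postcompose : ∀ {s t u} {P : Hom ⟦ t ⟧ ⟦ u ⟧} {p : Leaf t → Leaf u} →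
                (∀ i → P ∘ inj i ≡ inj (p i)) →
                (m : Leaf s → Leaf t) → P ∘ reindex m ≡ reindex (λ i → p (m i))
  postcompose {●}     acts m = acts (m here)
  postcompose {s ⊕ t} {P = P} {p} acts m =
    trans ∘-[] (cong₂ [_,_] (postcompose {P = P} {p} acts (λ i → m (left i)))
                            (postcompose {P = P} {p} acts (λ i → m (right i))))

  κ₁∘reindex : ∀ {s t u} (m : Leaf s → Leaf t) →
               κ₁ {⟦ t ⟧} {⟦ u ⟧} ∘ reindex m ≡ reindex (λ i → left {t = u} (m i))
  κ₁∘reindex = postcompose {P = κ₁} {p = left} (λ _ → refl)

  κ₂∘reindex : ∀ {s t u} (m : Leaf s → Leaf t) →
               κ₂ {⟦ u ⟧} {⟦ t ⟧} ∘ reindex m ≡ reindex (λ i → right {s = u} (m i))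
  κ₂∘reindex = postcompose {P = κ₂} {p = right} (λ _ → refl)

  reindex-id : ∀ {s} → reindex (idᴸ {s}) ≡ id
  reindex-id {●}     = refl
  reindex-id {s ⊕ t} = begin
    [ reindex (left {s} {t}) , reindex (right {s} {t}) ]
      ≡⟨ cong₂ [_,_] (sym (κ₁∘reindex {u = t} (idᴸ {s}))) (sym (κ₂∘reindex {u = s} (idᴸ {t}))) ⟩
    [ κ₁ ∘ reindex (idᴸ {s}) , κ₂ ∘ reindex (idᴸ {t}) ]
      ≡⟨ cong₂ [_,_] (trans (cong (κ₁ ∘_) (reindex-id {s})) identityʳ)
                     (trans (cong (κ₂ ∘_) (reindex-id {t})) identityʳ) ⟩
    [ κ₁ , κ₂ ]
      ≡⟨ [κ₁,κ₂]≡id ⟩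
    id ∎

  reindex-cong : ∀ {s t} {m k : Leaf s → Leaf t} → Every (λ i → m i ≡ k i) → reindex m ≡ reindex k
  reindex-cong {●}     e         = cong inj e
  reindex-cong {s ⊕ t} {m = m} {k} (e₁ , e₂) =
    cong₂ [_,_] (reindex-cong {m = λ i → m (left i)} {λ i → k (left i)} e₁)
                (reindex-cong {m = λ i → m (right i)} {λ i → k (right i)} e₂)

  record Realizes {s t} (M : Hom ⟦ s ⟧ ⟦ t ⟧) (m : Leaf s → Leaf t) : Set ℓ where
    constructor realized
    field realizes : M ≡ reindex m

  idʳ : ∀ {s} → Realizes (id {⟦ s ⟧}) (idᴸ {s})
  idʳ {s} = realized (sym (reindex-id {s}))

  κ₁ʳ : ∀ {s t} → Realizes (κ₁ {⟦ s ⟧} {⟦ t ⟧}) (left {s} {t})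
  κ₁ʳ {s} {t} = realized (trans (sym identityʳ)
    (trans (cong (κ₁ ∘_) (sym (reindex-id {s}))) (κ₁∘reindex {u = t} (idᴸ {s}))))

  κ₂ʳ : ∀ {s t} → Realizes (κ₂ {⟦ s ⟧} {⟦ t ⟧}) (right {s} {t})
  κ₂ʳ {s} {t} = realized (trans (sym identityʳ)
    (trans (cong (κ₂ ∘_) (sym (reindex-id {t}))) (κ₂∘reindex {u = s} (idᴸ {t}))))

  [_,_]ʳ : ∀ {s t u} {M : Hom ⟦ s ⟧ ⟦ u ⟧} {N : Hom ⟦ t ⟧ ⟦ u ⟧}
             {m : Leaf s → Leaf u} {n : Leaf t → Leaf u} →
           Realizes M m → Realizes N n → Realizes [ M , N ] [ m , n ]ᴸ
  [ realized e , realized e′ ]ʳ = realized (cong₂ [_,_] e e′)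

  infixr 9 _⊙_
  _⊙_ : ∀ {s t u} {M : Hom ⟦ t ⟧ ⟦ u ⟧} {N : Hom ⟦ s ⟧ ⟦ t ⟧}
          {m : Leaf t → Leaf u} {n : Leaf s → Leaf t} →
        Realizes M m → Realizes N n → Realizes (M ∘ N) (λ i → m (n i))
  _⊙_ {m = m} {n} (realized e) (realized e′) =
    realized (trans (cong₂ _∘_ e e′) (postcompose {P = reindex m} {m} (reindex-inj m) n))

  ∇ʳ : ∀ {s} → Realizes (∇ {⟦ s ⟧}) (∇ᴸ {s})
  ∇ʳ = [ idʳ , idʳ ]ʳ

  infixr 7 _+ʳ_
  _+ʳ_ : ∀ {s s′ t t′} {M : Hom ⟦ s ⟧ ⟦ s′ ⟧} {N : Hom ⟦ t ⟧ ⟦ t′ ⟧}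
           {m : Leaf s → Leaf s′} {n : Leaf t → Leaf t′} →
         Realizes M m → Realizes N n → Realizes (M +₁ N) (m +ᴸ n)
  Mʳ +ʳ Nʳ = [ κ₁ʳ ⊙ Mʳ , κ₂ʳ ⊙ Nʳ ]ʳ

  agree : ∀ {s t} {M K : Hom ⟦ s ⟧ ⟦ t ⟧} {m k : Leaf s → Leaf t} →
          Realizes M m → Realizes K k → Every (λ i → m i ≡ k i) → M ≡ K
  agree {m = m} {k} (realized e) (realized e′) leafwise =
    trans e (trans (reindex-cong {m = m} {k} leafwise) (sym e′))

𝟐 𝟑 𝟑′ 𝟒 : Shape
𝟐  = ● ⊕ ●
𝟑  = 𝟐 ⊕ ●
𝟑′ = ● ⊕ 𝟐
𝟒  = 𝟐 ⊕ 𝟐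

-- the two leaves of 𝟐; in 𝟑 = 𝟐 ⊕ ● the leaves are left ₁, left ₂ and ₂ = right here
pattern ₁ = left here
pattern ₂ = right here

δ₁ᴸ δ₂ᴸ : Leaf 𝟑 → Leaf 𝟐
δ₁ᴸ = [ idᴸ , right ]ᴸ
δ₂ᴸ = [ [ right , left ]ᴸ , right ]ᴸ

swapᴸ : Leaf 𝟑 → Leaf 𝟑
swapᴸ (left ₁) = left ₂
swapᴸ (left ₂) = left ₁
swapᴸ ₂        = ₂

-- the bound of 𝟎 ⊥ p: a p-part is sent to the second summand
zero-boundᴸ : Leaf 𝟐 → Leaf 𝟑
zero-boundᴸ ₁ = left ₂
zero-boundᴸ ₂ = ₂

assocᴸ : Leaf 𝟑 → Leaf 𝟑′
assocᴸ (left ₁) = ₁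
assocᴸ (left ₂) = right ₁
assocᴸ ₂        = right ₂

assoc⁻¹ᴸ : Leaf 𝟑′ → Leaf 𝟑
assoc⁻¹ᴸ ₁         = left ₁
assoc⁻¹ᴸ (right ₁) = left ₂
assoc⁻¹ᴸ (right ₂) = ₂

-- The leaves of 𝟒 are the parts p, q, r and "none" of a splitting of X;
-- these are the bounds of q ⊥ r and of p ⊥ q ⊞ r on such a splitting.
bound-q-rᴸ bound-p-qrᴸ : Leaf 𝟒 → Leaf 𝟑
bound-q-rᴸ (left ₁)  = ₂
bound-q-rᴸ (left ₂)  = left ₁
bound-q-rᴸ (right ₁) = left ₂
bound-q-rᴸ (right ₂) = ₂

bound-p-qrᴸ (left ₁)  = left ₁
bound-p-qrᴸ (left ₂)  = left ₂
bound-p-qrᴸ (right ₁) = left ₂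
bound-p-qrᴸ (right ₂) = ₂

module Laws {o ℓ} (𝒞 : CoprodCategory o ℓ) (X : CoprodCategory.Obj 𝒞) where
  open CoprodCategory 𝒞
  open Predicates 𝒞
  open Reindexing 𝒞 X

  δ₁ʳ : Realizes (δ₁ {X}) δ₁ᴸ
  δ₁ʳ = [ idʳ , κ₂ʳ ]ʳ

  δ₂ʳ : Realizes (δ₂ {X}) δ₂ᴸ
  δ₂ʳ = [ [ κ₂ʳ , κ₁ʳ ]ʳ , κ₂ʳ ]ʳ

  swap : Hom ((X + X) + X) ((X + X) + X)
  swap = reindex swapᴸ

  swapʳ : Realizes swap swapᴸ
  swapʳ = realized refl

  zero-bound : Hom (X + X) ((X + X) + X)
  zero-bound = reindex zero-boundᴸ

  zero-boundʳ : Realizes zero-bound zero-boundᴸ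
  zero-boundʳ = realized refl

  α : Hom ((X + X) + X) (X + (X + X))
  α = reindex assocᴸ

  αʳ : Realizes α assocᴸ
  αʳ = realized refl

  α⁻¹ : Hom (X + (X + X)) ((X + X) + X)
  α⁻¹ = reindex assoc⁻¹ᴸ

  α⁻¹ʳ : Realizes α⁻¹ assoc⁻¹ᴸ
  α⁻¹ʳ = realized refl

  bound-q-r bound-p-qr : Hom ((X + X) + (X + X)) ((X + X) + X)
  bound-q-r  = reindex bound-q-rᴸ
  bound-p-qr = reindex bound-p-qrᴸ

  bound-q-rʳ : Realizes bound-q-r bound-q-rᴸ
  bound-q-rʳ = realized refl

  bound-p-qrʳ : Realizes bound-p-qr bound-p-qrᴸ
  bound-p-qrʳ = realized refl

  δ₁∘swap : δ₁ ∘ swap ≡ δ₂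
  δ₁∘swap = agree (δ₁ʳ ⊙ swapʳ) δ₂ʳ ((refl , refl) , refl)

  δ₂∘swap : δ₂ ∘ swap ≡ δ₁
  δ₂∘swap = agree (δ₂ʳ ⊙ swapʳ) δ₁ʳ ((refl , refl) , refl)

  sum∘swap : (∇ +₁ id) ∘ swap ≡ ∇ +₁ id
  sum∘swap = agree ((∇ʳ +ʳ idʳ) ⊙ swapʳ) (∇ʳ +ʳ idʳ) ((refl , refl) , refl)

  δ₁∘zero-bound : δ₁ ∘ zero-bound ≡ κ₂ ∘ ∇
  δ₁∘zero-bound = agree (δ₁ʳ ⊙ zero-boundʳ) (κ₂ʳ ⊙ ∇ʳ) (refl , refl)

  δ₂∘zero-bound : δ₂ ∘ zero-bound ≡ id
  δ₂∘zero-bound = agree (δ₂ʳ ⊙ zero-boundʳ) idʳ (refl , refl)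

  sum∘zero-bound : (∇ +₁ id) ∘ zero-bound ≡ id
  sum∘zero-bound = agree ((∇ʳ +ʳ idʳ) ⊙ zero-boundʳ) idʳ (refl , refl)

  α⁻¹∘α : α⁻¹ ∘ α ≡ id
  α⁻¹∘α = agree (α⁻¹ʳ ⊙ αʳ) idʳ ((refl , refl) , refl)

  [id+∇]∘α : (id +₁ ∇) ∘ α ≡ δ₁
  [id+∇]∘α = agree ((idʳ +ʳ ∇ʳ) ⊙ αʳ) δ₁ʳ ((refl , refl) , refl)

  -- (vi): a bound whose first component is 𝟏 has second component 𝟎
  δ₂∘α⁻¹∘κ₁ : δ₂ ∘ (α⁻¹ ∘ κ₁) ≡ κ₂
  δ₂∘α⁻¹∘κ₁ = agree (δ₂ʳ ⊙ α⁻¹ʳ ⊙ κ₁ʳ) κ₂ʳ refl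

  -- (iii): on a splitting u of X into parts p, q, r, none, the bound of p ⊥ q
  -- is (id +₁ ∇) ∘ u and that of (p ⊞ q) ⊥ r is α⁻¹ ∘ (∇ +₁ id) ∘ u
  δ₁∘bound-q-r : δ₁ ∘ bound-q-r ≡ δ₂ ∘ (id +₁ ∇)
  δ₁∘bound-q-r = agree (δ₁ʳ ⊙ bound-q-rʳ) (δ₂ʳ ⊙ (idʳ +ʳ ∇ʳ)) ((refl , refl) , (refl , refl))

  δ₂∘bound-q-r : δ₂ ∘ bound-q-r ≡ δ₂ ∘ (α⁻¹ ∘ (∇ +₁ id))
  δ₂∘bound-q-r = agree (δ₂ʳ ⊙ bound-q-rʳ) (δ₂ʳ ⊙ α⁻¹ʳ ⊙ (∇ʳ +ʳ idʳ)) ((refl , refl) , (refl , refl))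

  δ₁∘bound-p-qr : δ₁ ∘ bound-p-qr ≡ δ₁ ∘ (id +₁ ∇)
  δ₁∘bound-p-qr = agree (δ₁ʳ ⊙ bound-p-qrʳ) (δ₁ʳ ⊙ (idʳ +ʳ ∇ʳ)) ((refl , refl) , (refl , refl))

  δ₂∘bound-p-qr : δ₂ ∘ bound-p-qr ≡ (∇ +₁ id) ∘ bound-q-r
  δ₂∘bound-p-qr = agree (δ₂ʳ ⊙ bound-p-qrʳ) ((∇ʳ +ʳ idʳ) ⊙ bound-q-rʳ) ((refl , refl) , (refl , refl))

  sum∘bound-p-qr : (∇ +₁ id) ∘ bound-p-qr ≡ (∇ +₁ id) ∘ (α⁻¹ ∘ (∇ +₁ id))
  sum∘bound-p-qr = agree ((∇ʳ +ʳ idʳ) ⊙ bound-p-qrʳ) ((∇ʳ +ʳ idʳ) ⊙ α⁻¹ʳ ⊙ (∇ʳ +ʳ idʳ))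
                         ((refl , refl) , (refl , refl))

module PartialSum {o ℓ} (𝒞 : CoprodCategory o ℓ) where
  open CoprodCategory 𝒞
  open Predicates 𝒞
  open CoproductCalculus 𝒞
  open ≡-Reasoning

  pullback-factor : ∀ {P A B C Z} {p₁ : Hom P A} {p₂ : Hom P B} {f : Hom A C} {g : Hom B C} →
                    IsPullback p₁ p₂ f g → (a : Hom Z A) (b : Hom Z B) → f ∘ a ≡ g ∘ b →
                    Σ (Hom Z P) λ u → (p₁ ∘ u ≡ a) × (p₂ ∘ u ≡ b)
  pullback-factor (_ , universal) a b commutes =
    let (u , factors , _) = universal a b commutes in u , factors

  -- (i) swapping the first two summands turns a bound of p, q into one of q, p
  ⊞-comm : ∀ {X} (p q : Pred X) (o : p ⊥⊥ q) →
           Σ (q ⊥⊥ p) λ o′ → pr (p ⊞[ o ] q) ≡ pr (q ⊞[ o′ ] p)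
  ⊞-comm {X} p q (b , e₁ , e₂) =
    (swap ∘ b , trans (precompose δ₁∘swap) e₂ , trans (precompose δ₂∘swap) e₁) ,
    sym (precompose sum∘swap)
    where open Laws 𝒞 X

  -- (ii) 𝟎 ⊥ p with the bound that never uses the first summand
  ⊞-identityˡ : ∀ {X} (p : Pred X) → Σ (𝟎 ⊥⊥ p) λ o → pr (𝟎 ⊞[ o ] p) ≡ pr p
  ⊞-identityˡ {X} p =
    (zero-bound ∘ pr p ,
     trans (transfer δ₁∘zero-bound (pr-∇ p)) identityʳ ,
     trans (precompose δ₂∘zero-bound) identityˡ) ,
    trans (precompose sum∘zero-bound) identityˡ
    where open Laws 𝒞 X

  -- (iii) the pullback (E) refines the bounds of p ⊥ q and (p ⊞ q) ⊥ r to a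
  -- splitting u of X into parts p, q, r, none, from which both new bounds are read off
  ⊞-assoc : SquareE →
            ∀ {X} (p q r : Pred X) (o₁ : p ⊥⊥ q) (o₂ : (p ⊞[ o₁ ] q) ⊥⊥ r) →
            Σ (q ⊥⊥ r) λ o₃ → Σ (p ⊥⊥ (q ⊞[ o₃ ] r)) λ o₄ →
              pr ((p ⊞[ o₁ ] q) ⊞[ o₂ ] r) ≡ pr (p ⊞[ o₄ ] (q ⊞[ o₃ ] r))
  ⊞-assoc squareE {X} p q r (b₁ , e₁ , e₂) (b₂ , f₁ , f₂) =
    (bound-q-r ∘ u ,
     trans (transfer δ₁∘bound-q-r split₁) e₂ ,
     trans (transfer δ₂∘bound-q-r split₂) f₂) ,
    (bound-p-qr ∘ u ,
     trans (transfer δ₁∘bound-p-qr split₁) e₁ ,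
     transfer δ₂∘bound-p-qr refl) ,
    sym (transfer sum∘bound-p-qr split₂)
    where
    open Laws 𝒞 X
    splitting : Σ (Hom X ((X + X) + (X + X))) λ u → ((id +₁ ∇) ∘ u ≡ b₁) × ((∇ +₁ id) ∘ u ≡ α ∘ b₂)
    splitting = pullback-factor (squareE {X + X} {X} {X + X} {X} ∇ ∇) b₁ (α ∘ b₂)
                                (trans (sym f₁) (sym (precompose [id+∇]∘α)))
    u : Hom X ((X + X) + (X + X))
    u = proj₁ splitting
    split₁ : (id +₁ ∇) ∘ u ≡ b₁
    split₁ = proj₁ (proj₂ splitting)
    split₂ : (α⁻¹ ∘ (∇ +₁ id)) ∘ u ≡ b₂
    split₂ = trans assoc (sym (solve-by-retraction α⁻¹∘α (sym (proj₂ (proj₂ splitting)))))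

  -- (iv) the bound of p ⊥ p^⊥ is p itself, landing in the first two summands
  ⊞-orthocomplement : ∀ {X} (p : Pred X) → Σ (p ⊥⊥ (p ⊥)) λ o → pr (p ⊞[ o ] (p ⊥)) ≡ pr 𝟏
  ⊞-orthocomplement p =
    (κ₁ ∘ pr p , trans (precompose inject₁) identityˡ , precompose inject₁) ,
    trans (transfer inject₁ (pr-∇ p)) identityʳ

  -- (v) by (K), a bound with sum 𝟏 factors through κ₁, and then it is κ₁ ∘ p
  orthocomplement-unique : SquareK →
    ∀ {X} (p q : Pred X) (o : p ⊥⊥ q) → pr (p ⊞[ o ] q) ≡ pr 𝟏 → pr q ≡ pr (p ⊥)
  orthocomplement-unique squareK {X} p q (b , e₁ , e₂) sum≡𝟏 = begin
      pr q               ≡⟨ sym e₂ ⟩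
      δ₂ ∘ b             ≡⟨ cong (δ₂ ∘_) (sym κ₁∘u≡b) ⟩
      δ₂ ∘ (κ₁ ∘ u)      ≡⟨ precompose inject₁ ⟩
      [ κ₂ , κ₁ ] ∘ u    ≡⟨ cong ([ κ₂ , κ₁ ] ∘_) u≡p ⟩
      [ κ₂ , κ₁ ] ∘ pr p ∎
    where
    factor : Σ (Hom X (X + X)) λ u → (∇ ∘ u ≡ id) × (κ₁ ∘ u ≡ b)
    factor = pullback-factor (squareK {X + X} {X} {X} ∇) id b (trans identityʳ (sym sum≡𝟏))
    u : Hom X (X + X)
    u = proj₁ factor
    κ₁∘u≡b : κ₁ ∘ u ≡ b
    κ₁∘u≡b = proj₂ (proj₂ factor)
    u≡p : u ≡ pr p
    u≡p = begin
      u             ≡⟨ sym identityˡ ⟩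
      id ∘ u        ≡⟨ sym (precompose inject₁) ⟩
      δ₁ ∘ (κ₁ ∘ u) ≡⟨ cong (δ₁ ∘_) κ₁∘u≡b ⟩
      δ₁ ∘ b        ≡⟨ e₁ ⟩
      pr p          ∎

  -- (vi) by (K+), a bound whose first component is 𝟏 factors through the
  -- first summand of X + (X + X), so its second component is 𝟎
  𝟏-orthogonal⇒𝟎 : SquareK+ → ∀ {X} (p : Pred X) → 𝟏 ⊥⊥ p → pr p ≡ pr 𝟎
  𝟏-orthogonal⇒𝟎 squareK+ {X} p (b , e₁ , e₂) = begin
      pr p                   ≡⟨ sym e₂ ⟩
      δ₂ ∘ b                 ≡⟨ cong (δ₂ ∘_) (solve-by-retraction α⁻¹∘α (sym κ₁∘u≡α∘b)) ⟩
      δ₂ ∘ (α⁻¹ ∘ (κ₁ ∘ u))  ≡⟨ cong (δ₂ ∘_) (sym assoc) ⟩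
      δ₂ ∘ ((α⁻¹ ∘ κ₁) ∘ u)  ≡⟨ precompose δ₂∘α⁻¹∘κ₁ ⟩
      κ₂ ∘ u                 ≡⟨ cong (κ₂ ∘_) (trans (sym identityˡ) id∘u≡id) ⟩
      κ₂ ∘ id                ≡⟨ identityʳ ⟩
      κ₂                     ∎
    where
    open Laws 𝒞 X
    factor : Σ (Hom X X) λ u → (id ∘ u ≡ id) × (κ₁ ∘ u ≡ α ∘ b)
    factor = pullback-factor (squareK+ {X} {X} {X + X} {X} id ∇) id (α ∘ b)
                             (trans identityʳ (trans (sym e₁) (sym (precompose [id+∇]∘α))))
    u : Hom X X
    u = proj₁ factor
    id∘u≡id : id ∘ u ≡ id
    id∘u≡id = proj₁ (proj₂ factor)
    κ₁∘u≡α∘b : κ₁ ∘ u ≡ α ∘ b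
    κ₁∘u≡α∘b = proj₂ (proj₂ factor)

-- Lemma 4.3.
lemma4p3 : ∀ {o ℓ} (𝒞 : CoprodCategory o ℓ) →
    let open Predicates 𝒞 in
    JointlyMonic →
    -- (i) commutativity
    (∀ {X} (p q : Pred X) (o : p ⊥⊥ q) →
      Σ (q ⊥⊥ p) λ o′ → pr (p ⊞[ o ] q) ≡ pr (q ⊞[ o′ ] p))
    ×
    -- (ii) 0 is neutral
    (∀ {X} (p : Pred X) →
      Σ (𝟎 ⊥⊥ p) λ o → pr (𝟎 ⊞[ o ] p) ≡ pr p)
    ×
    -- (iii) associativity, if (E) is a pullback
    (SquareE →
      ∀ {X} (p q r : Pred X) (o₁ : p ⊥⊥ q) (o₂ : (p ⊞[ o₁ ] q) ⊥⊥ r) →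
      Σ (q ⊥⊥ r) λ o₃ → Σ (p ⊥⊥ (q ⊞[ o₃ ] r)) λ o₄ →
        pr ((p ⊞[ o₁ ] q) ⊞[ o₂ ] r) ≡ pr (p ⊞[ o₄ ] (q ⊞[ o₃ ] r)))
    ×
    -- (iv) p ⊞ p^⊥ = 1
    (∀ {X} (p : Pred X) →
      Σ (p ⊥⊥ (p ⊥)) λ o → pr (p ⊞[ o ] (p ⊥)) ≡ pr 𝟏)
    ×
    -- (v) uniqueness of orthocomplement, if (K) is a pullback
    (SquareK →
      ∀ {X} (p q : Pred X) (o : p ⊥⊥ q) → pr (p ⊞[ o ] q) ≡ pr 𝟏 → pr q ≡ pr (p ⊥))
    ×
    -- (vi) if (K+) is a pullback, 1 ⊥ p implies p = 0
    (SquareK+ →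
      ∀ {X} (p : Pred X) → 𝟏 ⊥⊥ p → pr p ≡ pr 𝟎)
lemma4p3 𝒞 _ =
  ⊞-comm , ⊞-identityˡ , ⊞-assoc , ⊞-orthocomplement , orthocomplement-unique , 𝟏-orthogonal⇒𝟎
  where open PartialSum 𝒞
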